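{- Let $F, G$ be sets of ground clauses and let $C_0$ be the empty clause obtained with a provenance-labeled ground resolution proof from $F, G$. Then $\mathrm{ripol}(C_0)$ is a Craig-Lyndon interpolant for $F, \lnot G$ (clause sets read as conjunctions of their clauses).
   Context: Ground resolution calculus on clauses viewed as multisets of literals: from $C\lor L$ and $D\lor\bar L$ derive $C\lor D$; from $C\lor L\lor L$ derive $C\lor L$ (merge). In a provenance-labeled ground resolution proof for $F,G$ each literal occurrence carries a nonempty label $\subseteq\{\mathsf F,\mathsf G\}$: input clauses from $F$ have all labels $\{\mathsf F\}$, from $G$ all $\{\mathsf G\}$; resolvents inherit labels from premises; a merged literal gets the union of the labels of the two merged occurrences. $\mathrm{ripol}$: input clause from $F$: $\bot$; from $G$: $\top$; merge from $D$: $\mathrm{ripol}(D)$; resolvent $C\lor D$ of $C\lor L^{\mathcal A}$ and $D\lor\bar L^{\mathcal B}$ with $H_1,H_2$ the $\mathrm{ripol}$ values of the premises: $(\{\mathsf F\},\{\mathsf F\})$: $H_1\lor H_2$; $(\{\mathsf F\},\{\mathsf G\})$: $H_1\lor(L\land H_2)$ or alternatively $(L\lor H_1)\land H_2$; $(\{\mathsf F\},\{\mathsf F,\mathsf G\})$: $H_1\lor(L\land H_2)$; $(\{\mathsf G\},\{\mathsf G\})$: $H_1\land H_2$; $(\{\mathsf G\},\{\mathsf F,\mathsf G\})$: $H_1\land(\bar L\lor H_2)$; $(\{\mathsf F,\mathsf G\},\{\mathsf F,\mathsf G\})$: $(\bar L\land H_1)\lor(L\land H_2)$ or alternatively $(L\lor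 H_1)\land(\bar L\lor H_2)$. A Craig-Lyndon interpolant for $A,B$ with $A\models B$ is a formula $H$ with $A\models H$, $H\models B$, whose functions and free variables occur in both $A$ and $B$ and such that each predicate occurring in $H$ with positive (negative) polarity occurs with positive (negative) polarity in both $A$ and $B$. -}

module Defs where

open import Data.Bool using (Bool; true; false; not; T)
import Data.Bool as B
open import Data.List using (List; []; _∷_; _++_; map)
open import Data.List.Relation.Binary.Permutation.Propositional using (_↭_)
open import Data.List.Relation.Unary.Any using (Any)
open import Data.Product using (_×_; _,_; ∃)
open import Relation.Binary.PropositionalEquality using (_≡_)
open import Relation.Nullary using (¬_)
open import Data.Empty using (⊥)
open import Data.Sum using (_⊎_)

-- Fn : function symbols (constants are nullary), Pr : predicate symbols
variable
  Fn Pr : Set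

data Term (Fn : Set) : Set where
  fun : Fn → List (Term Fn) → Term Fn

record Atom (Fn Pr : Set) : Set where
  constructor _⦅_⦆
  field
    pred : Pr
    args : List (Term Fn)
open Atom public

data Literal (Fn Pr : Set) : Set where
  pos neg : Atom Fn Pr → Literal Fn Pr

compl : Literal Fn Pr → Literal Fn Pr
compl (pos a) = neg a
compl (neg a) = pos a

-- clauses are multisets of literals: lists, with permutation as a proof step
Clause : Set → Set → Set
Clause Fn Pr = List (Literal Fn Pr)

ClauseSet : Set → Set → Set₁
ClauseSet Fn Pr = Clause Fn Pr → Set

data Formula (Fn Pr : Set) : Set where
  ⊤ᶠ ⊥ᶠ : Formula Fn Pr
  atm   : Atom Fn Pr → Formula Fn Pr
  ¬ᶠ_   : Formula Fn Pr → Formula Fn Pr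
  _∧ᶠ_  : Formula Fn Pr → Formula Fn Pr → Formula Fn Pr
  _∨ᶠ_  : Formula Fn Pr → Formula Fn Pr → Formula Fn Pr

infixr 6 _∧ᶠ_
infixr 5 _∨ᶠ_

litF : Literal Fn Pr → Formula Fn Pr
litF (pos a) = atm a
litF (neg a) = ¬ᶠ atm a

Valuation : Set → Set → Set
Valuation Fn Pr = Atom Fn Pr → Bool

evalL : Valuation Fn Pr → Literal Fn Pr → Bool
evalL v (pos a) = v a
evalL v (neg a) = not (v a)

evalF : Valuation Fn Pr → Formula Fn Pr → Bool
evalF v ⊤ᶠ = true
evalF v ⊥ᶠ = false
evalF v (atm a) = v a
evalF v (¬ᶠ φ) = not (evalF v φ)
evalF v (φ ∧ᶠ ψ) = evalF v φ B.∧ evalF v ψ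
evalF v (φ ∨ᶠ ψ) = evalF v φ B.∨ evalF v ψ

SatC : Valuation Fn Pr → Clause Fn Pr → Set
SatC v C = Any (λ L → T (evalL v L)) C

SatS : Valuation Fn Pr → ClauseSet Fn Pr → Set
SatS v S = ∀ C → S C → SatC v C

data FunInTerm {Fn : Set} (f : Fn) : Term Fn → Set where
  here  : ∀ {ts} → FunInTerm f (fun f ts)
  under : ∀ {g ts} → Any (FunInTerm f) ts → FunInTerm f (fun g ts)

FunInAtom : Fn → Atom Fn Pr → Set
FunInAtom f a = Any (FunInTerm f) (args a)

FunInLit : Fn → Literal Fn Pr → Set
FunInLit f (pos a) = FunInAtom f a
FunInLit f (neg a) = FunInAtom f a

FunInS : Fn → ClauseSet Fn Pr → Set
FunInS f S = ∃ λ C → S C × Any (FunInLit f) C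

FunInF : Fn → Formula Fn Pr → Set
FunInF f ⊤ᶠ = ⊥
FunInF f ⊥ᶠ = ⊥
FunInF f (atm a) = FunInAtom f a
FunInF f (¬ᶠ φ) = FunInF f φ
FunInF f (φ ∧ᶠ ψ) = FunInF f φ ⊎ FunInF f ψ
FunInF f (φ ∨ᶠ ψ) = FunInF f φ ⊎ FunInF f ψ

data Polarity : Set where
  ⁺ ⁻ : Polarity

flipP : Polarity → Polarity
flipP ⁺ = ⁻
flipP ⁻ = ⁺

data PredInLit {Fn Pr : Set} : Polarity → Pr → Literal Fn Pr → Set where
  posOcc : ∀ {a} → PredInLit ⁺ (pred a) (pos a)
  negOcc : ∀ {a} → PredInLit ⁻ (pred a) (neg a)

PredInS : Polarity → Pr → ClauseSet Fn Pr → Set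
PredInS s p S = ∃ λ C → S C × Any (PredInLit s p) C

-- occurrence of p with polarity s in ¬(conjunction of the clauses of S)
PredInNegS : Polarity → Pr → ClauseSet Fn Pr → Set
PredInNegS s p S = PredInS (flipP s) p S

data PredInF {Fn Pr : Set} : Polarity → Pr → Formula Fn Pr → Set where
  atmOcc : ∀ {a} → PredInF ⁺ (pred a) (atm a)
  negF   : ∀ {s p φ} → PredInF (flipP s) p φ → PredInF s p (¬ᶠ φ)
  ∧ˡ     : ∀ {s p φ ψ} → PredInF s p φ → PredInF s p (φ ∧ᶠ ψ)
  ∧ʳ     : ∀ {s p φ ψ} → PredInF s p ψ → PredInF s p (φ ∧ᶠ ψ)
  ∨ˡ     : ∀ {s p φ ψ} → PredInF s p φ → PredInF s p (φ ∨ᶠ ψ)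
  ∨ʳ     : ∀ {s p φ ψ} → PredInF s p ψ → PredInF s p (φ ∨ᶠ ψ)

record CraigLyndonNeg (F G : ClauseSet Fn Pr) (H : Formula Fn Pr) : Set where
  field
    A⊨H   : ∀ (v : Valuation Fn Pr) → SatS v F → T (evalF v H)
    H⊨B   : ∀ (v : Valuation Fn Pr) → T (evalF v H) → ¬ SatS v G
    funs  : ∀ (f : Fn) → FunInF f H → FunInS f F × FunInS f G
    preds : ∀ (s : Polarity) (p : Pr) → PredInF s p H →
            PredInS s p F × PredInNegS s p G

data Label : Set where
  lF lG lFG : Label     -- {F}, {G}, {F,G}

_⊔_ : Label → Label → Label
lF ⊔ lF = lF
lG ⊔ lG = lG
_  ⊔ _  = lFG

LClause : Set → Set → Set
LClause Fn Pr = List (Literal Fn Pr × Label)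

labelAll : Label → Clause Fn Pr → LClause Fn Pr
labelAll l = map (λ L → L , l)

data Deriv {Fn Pr : Set} (F G : ClauseSet Fn Pr) : LClause Fn Pr → Set where
  inF   : ∀ {C} → F C → Deriv F G (labelAll lF C)
  inG   : ∀ {C} → G C → Deriv F G (labelAll lG C)
  perm  : ∀ {C C′} → Deriv F G C → C ↭ C′ → Deriv F G C′
  merge : ∀ {C L a b} → Deriv F G (C ++ (L , a) ∷ (L , b) ∷ []) →
          Deriv F G (C ++ (L , a ⊔ b) ∷ [])
  res   : ∀ {C D L} a b → Deriv F G (C ++ (L , a) ∷ []) →
          Deriv F G (D ++ (compl L , b) ∷ []) → Deriv F G (C ++ D)

-- Where the definition offers alternatives, both are allowed.  Label pairs
-- not listed in the definition are handled symmetrically (swap premises,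
-- the resolved literal then being L̄, and L̄̄ = L).
data Ripol {Fn Pr : Set} {F G : ClauseSet Fn Pr} :
     ∀ {C} → Deriv F G C → Formula Fn Pr → Set where
  rF     : ∀ {C} (x : F C) → Ripol (inF x) ⊥ᶠ
  rG     : ∀ {C} (x : G C) → Ripol (inG x) ⊤ᶠ
  rPerm  : ∀ {C C′ H} {d : Deriv F G C} {p : C ↭ C′} → Ripol d H → Ripol (perm d p) H
  rMerge : ∀ {C L a b H} {d : Deriv F G (C ++ (L , a) ∷ (L , b) ∷ [])} →
           Ripol d H → Ripol (merge d) H
  rFF    : ∀ {C D L H₁ H₂} {d₁ : Deriv F G (C ++ (L , lF) ∷ [])}
             {d₂ : Deriv F G (D ++ (compl L , lF) ∷ [])} →
           Ripol d₁ H₁ → Ripol d₂ H₂ → Ripol (res lF lF d₁ d₂) (H₁ ∨ᶠ H₂)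
  rFG₁   : ∀ {C D L H₁ H₂} {d₁ : Deriv F G (C ++ (L , lF) ∷ [])}
             {d₂ : Deriv F G (D ++ (compl L , lG) ∷ [])} →
           Ripol d₁ H₁ → Ripol d₂ H₂ →
           Ripol (res lF lG d₁ d₂) (H₁ ∨ᶠ (litF L ∧ᶠ H₂))
  rFG₂   : ∀ {C D L H₁ H₂} {d₁ : Deriv F G (C ++ (L , lF) ∷ [])}
             {d₂ : Deriv F G (D ++ (compl L , lG) ∷ [])} →
           Ripol d₁ H₁ → Ripol d₂ H₂ →
           Ripol (res lF lG d₁ d₂) ((litF L ∨ᶠ H₁) ∧ᶠ H₂)
  rFFG   : ∀ {C D L H₁ H₂} {d₁ : Deriv F G (C ++ (L , lF) ∷ [])}
             {d₂ : Deriv F G (D ++ (compl L , lFG) ∷ [])} →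
           Ripol d₁ H₁ → Ripol d₂ H₂ →
           Ripol (res lF lFG d₁ d₂) (H₁ ∨ᶠ (litF L ∧ᶠ H₂))
  rGG    : ∀ {C D L H₁ H₂} {d₁ : Deriv F G (C ++ (L , lG) ∷ [])}
             {d₂ : Deriv F G (D ++ (compl L , lG) ∷ [])} →
           Ripol d₁ H₁ → Ripol d₂ H₂ → Ripol (res lG lG d₁ d₂) (H₁ ∧ᶠ H₂)
  rGFG   : ∀ {C D L H₁ H₂} {d₁ : Deriv F G (C ++ (L , lG) ∷ [])}
             {d₂ : Deriv F G (D ++ (compl L , lFG) ∷ [])} →
           Ripol d₁ H₁ → Ripol d₂ H₂ →
           Ripol (res lG lFG d₁ d₂) (H₁ ∧ᶠ (litF (compl L) ∨ᶠ H₂))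
  rFGFG₁ : ∀ {C D L H₁ H₂} {d₁ : Deriv F G (C ++ (L , lFG) ∷ [])}
             {d₂ : Deriv F G (D ++ (compl L , lFG) ∷ [])} →
           Ripol d₁ H₁ → Ripol d₂ H₂ →
           Ripol (res lFG lFG d₁ d₂) ((litF (compl L) ∧ᶠ H₁) ∨ᶠ (litF L ∧ᶠ H₂))
  rFGFG₂ : ∀ {C D L H₁ H₂} {d₁ : Deriv F G (C ++ (L , lFG) ∷ [])}
             {d₂ : Deriv F G (D ++ (compl L , lFG) ∷ [])} →
           Ripol d₁ H₁ → Ripol d₂ H₂ →
           Ripol (res lFG lFG d₁ d₂) ((litF L ∨ᶠ H₁) ∧ᶠ (litF (compl L) ∨ᶠ H₂))
  rGF₁   : ∀ {C D L H₁ H₂} {d₁ : Deriv F G (C ++ (L , lG) ∷ [])}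
             {d₂ : Deriv F G (D ++ (compl L , lF) ∷ [])} →
           Ripol d₁ H₁ → Ripol d₂ H₂ →
           Ripol (res lG lF d₁ d₂) (H₂ ∨ᶠ (litF (compl L) ∧ᶠ H₁))
  rGF₂   : ∀ {C D L H₁ H₂} {d₁ : Deriv F G (C ++ (L , lG) ∷ [])}
             {d₂ : Deriv F G (D ++ (compl L , lF) ∷ [])} →
           Ripol d₁ H₁ → Ripol d₂ H₂ →
           Ripol (res lG lF d₁ d₂) ((litF (compl L) ∨ᶠ H₂) ∧ᶠ H₁)
  rFGF   : ∀ {C D L H₁ H₂} {d₁ : Deriv F G (C ++ (L , lFG) ∷ [])}
             {d₂ : Deriv F G (D ++ (compl L , lF) ∷ [])} →
           Ripol d₁ H₁ → Ripol d₂ H₂ →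
           Ripol (res lFG lF d₁ d₂) (H₂ ∨ᶠ (litF (compl L) ∧ᶠ H₁))
  rFGG   : ∀ {C D L H₁ H₂} {d₁ : Deriv F G (C ++ (L , lFG) ∷ [])}
             {d₂ : Deriv F G (D ++ (compl L , lG) ∷ [])} →
           Ripol d₁ H₁ → Ripol d₂ H₂ →
           Ripol (res lFG lG d₁ d₂) (H₂ ∧ᶠ (litF L ∨ᶠ H₁))

-- Every derived clause C with ripol value H is a partial interpolant: F ⊨ H ∨ C|F and
-- G ⊨ ¬H ∨ C|G, where C|X keeps the literals whose label contains X.  Each resolution
-- rule of ripol is exactly what makes this invariant survive the step, which is a
-- finite truth-table check.  Labels are also faithful (a literal labelled X occurs in X),
-- so a pivot literal L put into H occurs in F while its complement occurs in G, which
-- gives the Lyndon polarity condition for ¬G.  For the empty clause the invariant reads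
-- F ⊨ H and G ⊨ ¬H.
module Submission where

open import Defs
open import Data.List using ([]; _∷_; _++_)
open import Data.Bool using (Bool; true; false; not; T; _∧_; _∨_)
open import Data.Bool.Properties using (T-∧; T-∨; T-not-≡; not-involutive; ∨-idem)
open import Data.Unit using (tt)
open import Data.Product using (_×_; _,_; ∃; proj₁; proj₂)
open import Data.Sum using (_⊎_; inj₁; inj₂; [_,_]′; map₂)
open import Data.List.Relation.Unary.All using (All; []; _∷_; tabulate)
import Data.List.Relation.Unary.All as All
open import Data.List.Relation.Unary.All.Properties as Allₚ using (++⁻ˡ; ++⁻ʳ)
open import Data.List.Relation.Unary.Any using (Any; here; there)
import Data.List.Relation.Unary.Any as Any
open import Data.List.Relation.Unary.Any.Properties as Anyₚ using (++⁺ˡ; ++⁺ʳ; ++⁻; singleton⁻)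
open import Data.List.Relation.Binary.Permutation.Propositional using (_↭_)
open import Data.List.Relation.Binary.Permutation.Propositional.Properties
  using (All-resp-↭; Any-resp-↭)
open import Data.List.Membership.Propositional using (_∈_; lose)
open import Function.Base using (_∘_; id)
open import Function.Bundles using (Equivalence)
open import Relation.Binary.PropositionalEquality
  using (_≡_; refl; sym; trans; subst; subst₂)

open Equivalence using (to; from)

∀ᵇ : (Bool → Bool) → Bool
∀ᵇ f = f false ∧ f true

∀ᵇ-elim : ∀ f → T (∀ᵇ f) → ∀ x → T (f x)
∀ᵇ-elim f t false = proj₁ (to T-∧ t)
∀ᵇ-elim f t true  = proj₂ (to T-∧ t)

∀ᵇ³ : (Bool → Bool → Bool → Bool) → Bool
∀ᵇ³ f = ∀ᵇ λ x → ∀ᵇ λ y → ∀ᵇ (f x y)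

∀ᵇ³-elim : ∀ f → T (∀ᵇ³ f) → ∀ x y z → T (f x y z)
∀ᵇ³-elim f t x y =
  ∀ᵇ-elim (f x y) (∀ᵇ-elim (λ y → ∀ᵇ (f x y)) (∀ᵇ-elim (λ x → ∀ᵇ λ y → ∀ᵇ (f x y)) t x) y)

infixr 4 _⇒ᵇ_

_⇒ᵇ_ : Bool → Bool → Bool
x ⇒ᵇ y = not x ∨ y

⇒ᵇ-elim : ∀ {x y} → T (x ⇒ᵇ y) → T x → T y
⇒ᵇ-elim {true} t _ = t

data Side : Set where
  sideF sideG : Side

∀ˢ : (Side → Bool) → Bool
∀ˢ p = p sideF ∧ p sideG

∀ˢ-elim : ∀ p → T (∀ˢ p) → ∀ s → T (p s)
∀ˢ-elim p t sideF = proj₁ (to T-∧ t)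
∀ˢ-elim p t sideG = proj₂ (to T-∧ t)

onSide : Side → Label → Bool
onSide _     lFG = true
onSide sideF lF  = true
onSide sideF lG  = false
onSide sideG lF  = false
onSide sideG lG  = true

onSide-⊔ : ∀ s a b → onSide s (a ⊔ b) ≡ (onSide s a ∨ onSide s b)
onSide-⊔ s     lF  lF  = sym (∨-idem (onSide s lF))
onSide-⊔ s     lG  lG  = sym (∨-idem (onSide s lG))
onSide-⊔ s     lFG b   = refl
onSide-⊔ sideF lF  lG  = refl
onSide-⊔ sideG lF  lG  = refl
onSide-⊔ sideF lF  lFG = refl
onSide-⊔ sideG lF  lFG = refl
onSide-⊔ sideF lG  lF  = refl
onSide-⊔ sideG lG  lF  = refl
onSide-⊔ sideF lG  lFG = refl
onSide-⊔ sideG lG  lFG = refl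

onSide-⊔ˡ : ∀ {s} a b → T (onSide s a) → T (onSide s (a ⊔ b))
onSide-⊔ˡ {s} a b t = subst T (sym (onSide-⊔ s a b)) (from T-∨ (inj₁ t))

onSide-⊔ʳ : ∀ {s} a b → T (onSide s b) → T (onSide s (a ⊔ b))
onSide-⊔ʳ {s} a b t = subst T (sym (onSide-⊔ s a b)) (from T-∨ (inj₂ t))

onSide-⊔⁻ : ∀ {s} a b → T (onSide s (a ⊔ b)) → T (onSide s a) ⊎ T (onSide s b)
onSide-⊔⁻ {s} a b t = to T-∨ (subst T (onSide-⊔ s a b) t)

-- The formula H of an invariant appears positively for F and negated for G.
sign : Side → Bool → Bool
sign sideF b = b
sign sideG b = not b

-- A resolution step with premise labels a, b and ripol combination Φ h₁ h₂ L L̄ preserves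
-- partial interpolants on side s when this holds for all truth values.
resolutionRule : Label → Label → (Bool → Bool → Bool → Bool → Bool) →
                 Side → Bool → Bool → Bool → Bool
resolutionRule a b Φ s h₁ h₂ l =
  (sign s h₁ ∨ onSide s a ∧ l) ⇒ᵇ (sign s h₂ ∨ onSide s b ∧ not l) ⇒ᵇ
  sign s (Φ h₁ h₂ l (not l))

resolutionValid : Label → Label → (Bool → Bool → Bool → Bool → Bool) → Bool
resolutionValid a b Φ = ∀ˢ λ s → ∀ᵇ³ (resolutionRule a b Φ s)

resolutionValid-elim : ∀ {a b} Φ → T (resolutionValid a b Φ) → ∀ s h₁ h₂ l →
                       T (sign s h₁ ∨ onSide s a ∧ l) → T (sign s h₂ ∨ onSide s b ∧ not l) →
                       T (sign s (Φ h₁ h₂ l (not l)))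
resolutionValid-elim {a} {b} Φ valid s h₁ h₂ l =
  ⇒ᵇ-elim ∘ ⇒ᵇ-elim (∀ᵇ³-elim (resolutionRule a b Φ s)
                       (∀ˢ-elim (λ s → ∀ᵇ³ (resolutionRule a b Φ s)) valid s) h₁ h₂ l)

module _ {Fn Pr : Set} where

  compl-involutive : (L : Literal Fn Pr) → compl (compl L) ≡ L
  compl-involutive (pos a) = refl
  compl-involutive (neg a) = refl

  evalF-litF : ∀ v (L : Literal Fn Pr) → evalF v (litF L) ≡ evalL v L
  evalF-litF v (pos a) = refl
  evalF-litF v (neg a) = refl

  evalL-compl : ∀ v (L : Literal Fn Pr) → evalL v (compl L) ≡ not (evalL v L)
  evalL-compl v (pos a) = refl
  evalL-compl v (neg a) = sym (not-involutive (v a))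

  resolutionValid-at : ∀ {a b} Φ → T (resolutionValid a b Φ) →
                       ∀ s v (L : Literal Fn Pr) h₁ h₂ →
                       T (sign s h₁ ∨ onSide s a ∧ evalL v L) →
                       T (sign s h₂ ∨ onSide s b ∧ evalL v (compl L)) →
                       T (sign s (Φ h₁ h₂ (evalF v (litF L)) (evalF v (litF (compl L)))))
  resolutionValid-at {a} {b} Φ valid s v L h₁ h₂ p₁ p₂ =
    subst₂ (λ l l̄ → T (sign s (Φ h₁ h₂ l l̄))) (sym (evalF-litF v L)) (sym L̄-value)
      (resolutionValid-elim Φ valid s h₁ h₂ (evalL v L) p₁
        (subst (λ l̄ → T (sign s h₂ ∨ onSide s b ∧ l̄)) (evalL-compl v L) p₂))
    where
      L̄-value : evalF v (litF (compl L)) ≡ not (evalL v L)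
      L̄-value = trans (evalF-litF v (compl L)) (evalL-compl v L)

  FunInF-litF : ∀ {f} (L : Literal Fn Pr) → FunInF f (litF L) → FunInLit f L
  FunInF-litF (pos a) x = x
  FunInF-litF (neg a) x = x

  FunInLit-compl : ∀ {f} (L : Literal Fn Pr) → FunInLit f L → FunInLit f (compl L)
  FunInLit-compl (pos a) x = x
  FunInLit-compl (neg a) x = x

  PredInF-litF : ∀ {s p} (L : Literal Fn Pr) → PredInF s p (litF L) → PredInLit s p L
  PredInF-litF (pos a) atmOcc = posOcc
  PredInF-litF {⁺} (neg a) (negF ())
  PredInF-litF {⁻} (neg a) (negF atmOcc) = negOcc

  PredInLit-compl : ∀ {s p} {L : Literal Fn Pr} → PredInLit s p L →
                    PredInLit (flipP s) p (compl L)
  PredInLit-compl posOcc = negOcc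
  PredInLit-compl negOcc = posOcc

  SatOn : Side → Valuation Fn Pr → LClause Fn Pr → Set
  SatOn s v = Any (λ (L , l) → T (onSide s l) × T (evalL v L))

  SatOn-labelAll : ∀ {s l v} {C : Clause Fn Pr} → T (onSide s l) → SatC v C →
                   SatOn s v (labelAll l C)
  SatOn-labelAll t sat = Anyₚ.map⁺ (Any.map (t ,_) sat)

  SatOn-merge : ∀ {s v} C {L : Literal Fn Pr} a b →
                SatOn s v (C ++ (L , a) ∷ (L , b) ∷ []) → SatOn s v (C ++ (L , a ⊔ b) ∷ [])
  SatOn-merge C a b sat with ++⁻ C sat
  ... | inj₁ satC                   = ++⁺ˡ satC
  ... | inj₂ (here (t , l))         = ++⁺ʳ C (here (onSide-⊔ˡ a b t , l))
  ... | inj₂ (there (here (t , l))) = ++⁺ʳ C (here (onSide-⊔ʳ a b t , l))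

module _ {Fn Pr : Set} (F G : ClauseSet Fn Pr) where

  record SharedSymbols (H : Formula Fn Pr) : Set where
    field
      funs  : ∀ (f : Fn) → FunInF f H → FunInS f F × FunInS f G
      preds : ∀ (s : Polarity) (p : Pr) → PredInF s p H →
              PredInS s p F × PredInNegS s p G
  open SharedSymbols

  ⊤-shared : SharedSymbols ⊤ᶠ
  ⊤-shared = record { funs = λ _ () ; preds = λ _ _ () }

  ⊥-shared : SharedSymbols ⊥ᶠ
  ⊥-shared = record { funs = λ _ () ; preds = λ _ _ () }

  ∨-shared : ∀ {H₁ H₂} → SharedSymbols H₁ → SharedSymbols H₂ → SharedSymbols (H₁ ∨ᶠ H₂)
  ∨-shared sh₁ sh₂ = record
    { funs  = λ { f (inj₁ x) → funs sh₁ f x ; f (inj₂ x) → funs sh₂ f x }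
    ; preds = λ { s p (∨ˡ x) → preds sh₁ s p x ; s p (∨ʳ x) → preds sh₂ s p x } }

  ∧-shared : ∀ {H₁ H₂} → SharedSymbols H₁ → SharedSymbols H₂ → SharedSymbols (H₁ ∧ᶠ H₂)
  ∧-shared sh₁ sh₂ = record
    { funs  = λ { f (inj₁ x) → funs sh₁ f x ; f (inj₂ x) → funs sh₂ f x }
    ; preds = λ { s p (∧ˡ x) → preds sh₁ s p x ; s p (∧ʳ x) → preds sh₂ s p x } }

  LitInS : Literal Fn Pr → ClauseSet Fn Pr → Set
  LitInS L S = ∃ λ C → S C × L ∈ C

  FunInS-LitInS : ∀ {f L S} → LitInS L S → FunInLit f L → FunInS f S
  FunInS-LitInS (C , x , L∈C) fL = C , x , lose L∈C fL

  PredInS-LitInS : ∀ {s p L S} → LitInS L S → PredInLit s p L → PredInS s p S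
  PredInS-LitInS (C , x , L∈C) pL = C , x , lose L∈C pL

  literal-shared : ∀ {L} → LitInS L F → LitInS (compl L) G → SharedSymbols (litF L)
  literal-shared {L} L∈F L̄∈G = record
    { funs  = λ f x → let fL = FunInF-litF L x in
                FunInS-LitInS L∈F fL , FunInS-LitInS L̄∈G (FunInLit-compl L fL)
    ; preds = λ s p x → let pL = PredInF-litF L x in
                PredInS-LitInS L∈F pL , PredInS-LitInS L̄∈G (PredInLit-compl pL) }

  clausesOf : Side → ClauseSet Fn Pr
  clausesOf sideF = F
  clausesOf sideG = G

  WellLabelled : Literal Fn Pr × Label → Set
  WellLabelled (L , l) = ∀ s → T (onSide s l) → LitInS L (clausesOf s)

  merge-wellLabelled : ∀ {L} a b → WellLabelled (L , a) → WellLabelled (L , b) →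
                       WellLabelled (L , a ⊔ b)
  merge-wellLabelled a b wa wb s t = [ wa s , wb s ]′ (onSide-⊔⁻ a b t)

  wellLabelled : ∀ {C} → Deriv F G C → All WellLabelled C
  wellLabelled (inF {C} x) =
    Allₚ.map⁺ (tabulate λ L∈C → λ { sideF _ → C , x , L∈C ; sideG () })
  wellLabelled (inG {C} x) =
    Allₚ.map⁺ (tabulate λ L∈C → λ { sideF () ; sideG _ → C , x , L∈C })
  wellLabelled (perm d p) = All-resp-↭ p (wellLabelled d)
  wellLabelled (merge {C} {a = a} {b} d) =
    Allₚ.++⁺ (++⁻ˡ C labels)
             (merge-wellLabelled a b (All.head merged) (All.head (All.tail merged)) ∷ [])
    where
      labels = wellLabelled d
      merged = ++⁻ʳ C labels
  wellLabelled (res {C} {D} a b d₁ d₂) =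
    Allₚ.++⁺ (++⁻ˡ C (wellLabelled d₁)) (++⁻ˡ D (wellLabelled d₂))

  labelled-occurrence : ∀ {C L a} s → Deriv F G (C ++ (L , a) ∷ []) → T (onSide s a) →
                        LitInS L (clausesOf s)
  labelled-occurrence {C} s d = All.head (++⁻ʳ C (wellLabelled d)) s

  pivot-shared : ∀ {C D L a b} →
                 Deriv F G (C ++ (L , a) ∷ []) → Deriv F G (D ++ (compl L , b) ∷ []) →
                 T (onSide sideF a) → T (onSide sideG b) → SharedSymbols (litF L)
  pivot-shared d₁ d₂ a∋F b∋G =
    literal-shared (labelled-occurrence sideF d₁ a∋F) (labelled-occurrence sideG d₂ b∋G)

  pivotᶜ-shared : ∀ {C D L a b} →
                  Deriv F G (C ++ (L , a) ∷ []) → Deriv F G (D ++ (compl L , b) ∷ []) →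
                  T (onSide sideG a) → T (onSide sideF b) → SharedSymbols (litF (compl L))
  pivotᶜ-shared {L = L} d₁ d₂ a∋G b∋F =
    literal-shared (labelled-occurrence sideF d₂ b∋F)
                   (subst (λ K → LitInS K G) (sym (compl-involutive L))
                          (labelled-occurrence sideG d₁ a∋G))

  ripol-shared : ∀ {C} {d : Deriv F G C} {H} → Ripol d H → SharedSymbols H
  ripol-shared (rF _)      = ⊥-shared
  ripol-shared (rG _)      = ⊤-shared
  ripol-shared (rPerm r)   = ripol-shared r
  ripol-shared (rMerge r)  = ripol-shared r
  ripol-shared (rFF r₁ r₂) = ∨-shared (ripol-shared r₁) (ripol-shared r₂)
  ripol-shared (rGG r₁ r₂) = ∧-shared (ripol-shared r₁) (ripol-shared r₂)
  ripol-shared (rFG₁ {d₁ = d₁} {d₂} r₁ r₂) =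
    ∨-shared (ripol-shared r₁) (∧-shared (pivot-shared d₁ d₂ tt tt) (ripol-shared r₂))
  ripol-shared (rFG₂ {d₁ = d₁} {d₂} r₁ r₂) =
    ∧-shared (∨-shared (pivot-shared d₁ d₂ tt tt) (ripol-shared r₁)) (ripol-shared r₂)
  ripol-shared (rFFG {d₁ = d₁} {d₂} r₁ r₂) =
    ∨-shared (ripol-shared r₁) (∧-shared (pivot-shared d₁ d₂ tt tt) (ripol-shared r₂))
  ripol-shared (rGFG {d₁ = d₁} {d₂} r₁ r₂) =
    ∧-shared (ripol-shared r₁) (∨-shared (pivotᶜ-shared d₁ d₂ tt tt) (ripol-shared r₂))
  ripol-shared (rFGFG₁ {d₁ = d₁} {d₂} r₁ r₂) =
    ∨-shared (∧-shared (pivotᶜ-shared d₁ d₂ tt tt) (ripol-shared r₁))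
             (∧-shared (pivot-shared d₁ d₂ tt tt) (ripol-shared r₂))
  ripol-shared (rFGFG₂ {d₁ = d₁} {d₂} r₁ r₂) =
    ∧-shared (∨-shared (pivot-shared d₁ d₂ tt tt) (ripol-shared r₁))
             (∨-shared (pivotᶜ-shared d₁ d₂ tt tt) (ripol-shared r₂))
  ripol-shared (rGF₁ {d₁ = d₁} {d₂} r₁ r₂) =
    ∨-shared (ripol-shared r₂) (∧-shared (pivotᶜ-shared d₁ d₂ tt tt) (ripol-shared r₁))
  ripol-shared (rGF₂ {d₁ = d₁} {d₂} r₁ r₂) =
    ∧-shared (∨-shared (pivotᶜ-shared d₁ d₂ tt tt) (ripol-shared r₂)) (ripol-shared r₁)
  ripol-shared (rFGF {d₁ = d₁} {d₂} r₁ r₂) =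
    ∨-shared (ripol-shared r₂) (∧-shared (pivotᶜ-shared d₁ d₂ tt tt) (ripol-shared r₁))
  ripol-shared (rFGG {d₁ = d₁} {d₂} r₁ r₂) =
    ∧-shared (ripol-shared r₂) (∨-shared (pivot-shared d₁ d₂ tt tt) (ripol-shared r₁))

  PartialInterpolant : LClause Fn Pr → (Valuation Fn Pr → Bool) → Set
  PartialInterpolant C h =
    ∀ s v → SatS v (clausesOf s) → T (sign s (h v)) ⊎ SatOn s v C

  inF-interpolant : ∀ {C} → F C → PartialInterpolant (labelAll lF C) (λ _ → false)
  inF-interpolant x sideF v ⊨F = inj₂ (SatOn-labelAll tt (⊨F _ x))
  inF-interpolant x sideG v _  = inj₁ tt

  inG-interpolant : ∀ {C} → G C → PartialInterpolant (labelAll lG C) (λ _ → true)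
  inG-interpolant x sideF v _  = inj₁ tt
  inG-interpolant x sideG v ⊨G = inj₂ (SatOn-labelAll tt (⊨G _ x))

  perm-interpolant : ∀ {C C′ h} → C ↭ C′ → PartialInterpolant C h → PartialInterpolant C′ h
  perm-interpolant p I s v ⊨ = map₂ (Any-resp-↭ p) (I s v ⊨)

  merge-interpolant : ∀ {C L a b h} →
                      PartialInterpolant (C ++ (L , a) ∷ (L , b) ∷ []) h →
                      PartialInterpolant (C ++ (L , a ⊔ b) ∷ []) h
  merge-interpolant {C} {a = a} {b} I s v ⊨ = map₂ (SatOn-merge C a b) (I s v ⊨)

  split-pivot : ∀ C {L : Literal Fn Pr} {a s v b} →
                T (sign s b) ⊎ SatOn s v (C ++ (L , a) ∷ []) →
                SatOn s v C ⊎ T (sign s b ∨ onSide s a ∧ evalL v L)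
  split-pivot C (inj₁ t) = inj₂ (from T-∨ (inj₁ t))
  split-pivot C (inj₂ sat) =
    map₂ (λ pivot → from T-∨ (inj₂ (from T-∧ (singleton⁻ pivot)))) (++⁻ C sat)

  resolution-interpolant :
    ∀ {C D L a b h₁ h₂} (Φ : Bool → Bool → Bool → Bool → Bool) → T (resolutionValid a b Φ) →
    PartialInterpolant (C ++ (L , a) ∷ []) h₁ →
    PartialInterpolant (D ++ (compl L , b) ∷ []) h₂ →
    PartialInterpolant (C ++ D)
      (λ v → Φ (h₁ v) (h₂ v) (evalF v (litF L)) (evalF v (litF (compl L))))
  resolution-interpolant {C} {D} {L} {h₁ = h₁} {h₂} Φ valid I₁ I₂ s v ⊨
    with split-pivot C (I₁ s v ⊨) | split-pivot D (I₂ s v ⊨)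
  ... | inj₁ satC | _         = inj₂ (++⁺ˡ satC)
  ... | inj₂ _    | inj₁ satD = inj₂ (++⁺ʳ C satD)
  ... | inj₂ p₁   | inj₂ p₂   = inj₁ (resolutionValid-at Φ valid s v L (h₁ v) (h₂ v) p₁ p₂)

  ripol-interpolant : ∀ {C} {d : Deriv F G C} {H} → Ripol d H →
                      PartialInterpolant C (λ v → evalF v H)
  ripol-interpolant (rF x)            = inF-interpolant x
  ripol-interpolant (rG x)            = inG-interpolant x
  ripol-interpolant (rPerm {p = p} r) = perm-interpolant p (ripol-interpolant r)
  ripol-interpolant (rMerge r)        = merge-interpolant (ripol-interpolant r)
  ripol-interpolant (rFF r₁ r₂) =
    resolution-interpolant (λ h₁ h₂ _ _ → h₁ ∨ h₂) tt
      (ripol-interpolant r₁) (ripol-interpolant r₂)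
  ripol-interpolant (rFG₁ r₁ r₂) =
    resolution-interpolant (λ h₁ h₂ l _ → h₁ ∨ l ∧ h₂) tt
      (ripol-interpolant r₁) (ripol-interpolant r₂)
  ripol-interpolant (rFG₂ r₁ r₂) =
    resolution-interpolant (λ h₁ h₂ l _ → (l ∨ h₁) ∧ h₂) tt
      (ripol-interpolant r₁) (ripol-interpolant r₂)
  ripol-interpolant (rFFG r₁ r₂) =
    resolution-interpolant (λ h₁ h₂ l _ → h₁ ∨ l ∧ h₂) tt
      (ripol-interpolant r₁) (ripol-interpolant r₂)
  ripol-interpolant (rGG r₁ r₂) =
    resolution-interpolant (λ h₁ h₂ _ _ → h₁ ∧ h₂) tt
      (ripol-interpolant r₁) (ripol-interpolant r₂)
  ripol-interpolant (rGFG r₁ r₂) =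
    resolution-interpolant (λ h₁ h₂ _ l̄ → h₁ ∧ (l̄ ∨ h₂)) tt
      (ripol-interpolant r₁) (ripol-interpolant r₂)
  ripol-interpolant (rFGFG₁ r₁ r₂) =
    resolution-interpolant (λ h₁ h₂ l l̄ → l̄ ∧ h₁ ∨ l ∧ h₂) tt
      (ripol-interpolant r₁) (ripol-interpolant r₂)
  ripol-interpolant (rFGFG₂ r₁ r₂) =
    resolution-interpolant (λ h₁ h₂ l l̄ → (l ∨ h₁) ∧ (l̄ ∨ h₂)) tt
      (ripol-interpolant r₁) (ripol-interpolant r₂)
  ripol-interpolant (rGF₁ r₁ r₂) =
    resolution-interpolant (λ h₁ h₂ _ l̄ → h₂ ∨ l̄ ∧ h₁) tt
      (ripol-interpolant r₁) (ripol-interpolant r₂)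
  ripol-interpolant (rGF₂ r₁ r₂) =
    resolution-interpolant (λ h₁ h₂ _ l̄ → (l̄ ∨ h₂) ∧ h₁) tt
      (ripol-interpolant r₁) (ripol-interpolant r₂)
  ripol-interpolant (rFGF r₁ r₂) =
    resolution-interpolant (λ h₁ h₂ _ l̄ → h₂ ∨ l̄ ∧ h₁) tt
      (ripol-interpolant r₁) (ripol-interpolant r₂)
  ripol-interpolant (rFGG r₁ r₂) =
    resolution-interpolant (λ h₁ h₂ l _ → h₂ ∧ (l ∨ h₁)) tt
      (ripol-interpolant r₁) (ripol-interpolant r₂)

mainTheorem6 : ∀ {Fn Pr : Set} (F G : ClauseSet Fn Pr) (d : Deriv F G [])
                 (H : Formula Fn Pr) → Ripol d H → CraigLyndonNeg F G H
mainTheorem6 F G d H r = record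
  { A⊨H   = λ v ⊨F → [ id , (λ ()) ]′ (interpolant sideF v ⊨F)
  ; H⊨B   = λ v H-holds ⊨G →
      [ (λ ¬H → subst T (to T-not-≡ ¬H) H-holds) , (λ ()) ]′ (interpolant sideG v ⊨G)
  ; funs  = SharedSymbols.funs shared
  ; preds = SharedSymbols.preds shared }
  where
    interpolant = ripol-interpolant F G r
    shared      = ripol-shared F G r
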